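{- Let $n\ge1$ and let $\rho_1,\rho_2,\rho_3$ be fixed-point-free involutions on $\{1,\dots,2n\}$ such that the group $\langle\rho_1,\rho_2,\rho_3\rangle$ acts transitively on $\{1,\dots,2n\}$. Suppose $\sigma$ and $\sigma'$ are cyclic orders on $\{1,\dots,2n\}$ such that the orbit partition of each $\rho_i$ is intersection-free with respect to $\sigma$, and likewise with respect to $\sigma'$. Then the even-distance relation with respect to $\sigma$ coincides with the even-distance relation with respect to $\sigma'$; that is, the even-distance relation depends only on $\rho_1,\rho_2,\rho_3$.
   Context: A cyclic order on a finite set $M$ is a cycle $\sigma\in\mathrm{Sym}(M)$ of length $|M|$. A partition $\mathcal P$ of $M$ into two-element subsets is intersection-free with respect to $\sigma$ if there do not exist $m\in M$ and integers $1\le i<j<k<|M|$ with $\{m,\sigma^j(m)\}\in\mathcal P$ and $\{\sigma^i(m),\sigma^k(m)\}\in\mathcal P$. For a cyclic order $\sigma$ on $\{1,\dots,2n\}$, two elements $a,b$ have even distance (with respect to $\sigma$) if $b=\sigma^k(a)$ for some even integer $k$ (well defined since $\sigma$ has even order $2n$), and odd distance otherwise. -}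

module Defs where

open import Data.Nat using (ℕ; zero; suc; _<_; _≤_; _*_)
open import Data.Nat.Divisibility using (_∣_)
open import Data.Fin using (Fin)
open import Data.Fin.Permutation using (Permutation′; _⟨$⟩ʳ_)
open import Data.List using (List; []; _∷_)
open import Data.Product using (∃-syntax; _×_)
open import Relation.Binary.PropositionalEquality using (_≡_; _≢_)
open import Relation.Nullary using (¬_)

iter : {A : Set} → (A → A) → ℕ → A → A
iter f zero    x = x
iter f (suc k) x = f (iter f k x)

_^[_] : {m : ℕ} → Permutation′ m → ℕ → Fin m → Fin m
σ ^[ k ] = iter (σ ⟨$⟩ʳ_) k

IsCyclicOrder : {m : ℕ} → Permutation′ m → Set
IsCyclicOrder {m} σ = ∀ (a b : Fin m) → ∃[ k ] (σ ^[ k ]) a ≡ b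

IsFPFInvolution : {m : ℕ} → (Fin m → Fin m) → Set
IsFPFInvolution {m} ρ = (∀ x → ρ (ρ x) ≡ x) × (∀ x → ρ x ≢ x)

-- the orbit partition of a fixed-point-free involution ρ consists of the
-- pairs {x , ρ x}; {x , y} is a block iff ρ x ≡ y.
-- Intersection-free w.r.t. σ (on a set of size m):
IntersectionFree : {m : ℕ} → (Fin m → Fin m) → Permutation′ m → Set
IntersectionFree {m} ρ σ =
  ¬ (∃[ x ] ∃[ i ] ∃[ j ] ∃[ k ]
       (1 ≤ i × i < j × j < k × k < m
        × ρ x ≡ (σ ^[ j ]) x
        × ρ ((σ ^[ i ]) x) ≡ (σ ^[ k ]) x))

applyWord : {m : ℕ} → (Fin 3 → Fin m → Fin m) → List (Fin 3) → Fin m → Fin m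
applyWord ρ []       x = x
applyWord ρ (g ∷ gs) x = ρ g (applyWord ρ gs x)

-- the group generated by the (involutions) ρ g acts transitively
-- (every group element is a word in the generators since each is an involution)
GeneratesTransitive : {m : ℕ} → (Fin 3 → Fin m → Fin m) → Set
GeneratesTransitive {m} ρ = ∀ (a b : Fin m) → ∃[ w ] applyWord ρ w a ≡ b

EvenDist : {m : ℕ} → Permutation′ m → Fin m → Fin m → Set
EvenDist σ a b = ∃[ k ] (2 ∣ k × (σ ^[ k ]) a ≡ b)

-- Number the points of the cycle σ⁰ a, σ¹ a, …, σ^(2n−1) a from a base point a. An intersection-free
-- fixed-point-free involution ρ then becomes a non-crossing perfect matching of the positions
-- 0, …, 2n−1, so the positions strictly between 0 and the partner of 0 are matched among themselves.
-- An interval closed under a matching has even length, hence σᵏ a = ρ a for some odd k. As the cycle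
-- has even length, the parity of a k with σᵏ x = y is determined by x and y; it adds up along a word
-- in the ρ g, so a and b have even distance iff a word carrying a to b has even length, which does
-- not involve σ at all.
module Submission where

open import Defs
open import Data.Nat using (ℕ; zero; suc; _+_; _*_; _∸_; _≤_; _<_; z≤n; NonZero; parity)
open import Data.Nat.Properties
open import Data.Nat.DivMod using (_%_; _/_; m≡m%n+[m/n]*n; m%n<n)
open import Data.Nat.Divisibility using (_∣_; divides; ∣⇒≤; ∣-trans; m%n≡0⇒n∣m)
open import Data.Nat.Induction using (<-wellFounded)
open import Data.Nat.Tactic.RingSolver using (solve-∀)
open import Data.Parity.Base as ℙ using (Parity; 0ℙ; 1ℙ; _⁻¹)
import Data.Parity.Properties as ℙₚ
open import Data.Fin using (Fin; toℕ; fromℕ<)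
open import Data.Fin.Properties using (pigeonhole; toℕ-fromℕ<; toℕ<n; nonZeroIndex; injective⇒≤)
open import Data.Fin.Permutation using (Permutation′; _⟨$⟩ˡ_; inverseˡ)
open import Data.List using ([]; _∷_; length)
open import Data.Product using (∃-syntax; _×_; _,_; proj₁; proj₂)
open import Data.Sum using (inj₁; inj₂)
open import Data.Empty using (⊥; ⊥-elim)
open import Function.Bundles using (_⇔_; mk⇔)
open import Function.Construct.Composition using (_⇔-∘_)
open import Function.Construct.Symmetry using (⇔-sym)
open import Induction.WellFounded using (Acc; acc)
open import Relation.Binary using (tri<; tri≈; tri>)
open import Relation.Binary.PropositionalEquality
open import Relation.Nullary using (¬_; yes; no; contradiction)

even⇒parity≡0ℙ : ∀ k → 2 ∣ k → parity k ≡ 0ℙ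
even⇒parity≡0ℙ .(q * 2) (divides q refl) = trans (ℙₚ.*-homo-* q 2) (ℙₚ.*-zeroʳ (parity q))

parity≡0ℙ⇒even : ∀ k → parity k ≡ 0ℙ → 2 ∣ k
parity≡0ℙ⇒even zero          _    = divides 0 refl
parity≡0ℙ⇒even (suc (suc k)) even with divides q k≡q*2 ← parity≡0ℙ⇒even k even =
  divides (suc q) (cong (2 +_) k≡q*2)

parity-suc : ∀ {n p} → parity n ≡ p → parity (suc n) ≡ p ⁻¹
parity-suc {n} refl = ℙₚ.+-homo-+ 1 n

∣∧<⇒≡0 : ∀ {m n} → m ∣ n → n < m → n ≡ 0
∣∧<⇒≡0 {n = zero}  _   _   = refl
∣∧<⇒≡0 {n = suc _} m∣n n<m = contradiction (∣⇒≤ m∣n) (<⇒≱ n<m)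

∸-split : ∀ {lo j hi} → lo < j → j < hi → hi ∸ lo ≡ 2 + ((j ∸ suc lo) + (hi ∸ suc j))
∸-split {lo} {j} {hi} lo<j j<hi = begin
  hi ∸ lo                       ≡⟨ cong (_∸ lo) hi≡ ⟩
  lo + (2 + (L₁ + L₂)) ∸ lo     ≡⟨ m+n∸m≡n lo _ ⟩
  2 + (L₁ + L₂)                 ∎
  where
  open ≡-Reasoning
  L₁ = j ∸ suc lo
  L₂ = hi ∸ suc j
  rearrange : ∀ a b c → suc (suc a + b) + c ≡ a + (2 + (b + c))
  rearrange = solve-∀
  hi≡ : hi ≡ lo + (2 + (L₁ + L₂))
  hi≡ = begin
    hi                          ≡⟨ m+[n∸m]≡n j<hi ⟨
    suc j + L₂                  ≡⟨ cong (λ k → suc k + L₂) (m+[n∸m]≡n lo<j) ⟨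
    suc (suc lo + L₁) + L₂      ≡⟨ rearrange lo L₁ L₂ ⟩
    lo + (2 + (L₁ + L₂))        ∎

record IsNonCrossingMatching (m : ℕ) (c : ℕ → ℕ) : Set where
  field
    bounded        : ∀ {i} → i < m → c i < m
    involutive     : ∀ {i} → i < m → c (c i) ≡ i
    fixedPointFree : ∀ {i} → i < m → c i ≢ i
    nonCrossing    : ∀ {u s v t} → u < s → s < v → v < t → t < m → c u ≡ v → c s ≡ t → ⊥

module NonCrossingMatching {m : ℕ} {c : ℕ → ℕ} (M : IsNonCrossingMatching m c) where
  open IsNonCrossingMatching M

  injective : ∀ {i j} → i < m → j < m → c i ≡ c j → i ≡ j
  injective i<m j<m ci≡cj = trans (sym (involutive i<m)) (trans (cong c ci≡cj) (involutive j<m))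

  nested : ∀ {lo j i} → j < m → c lo ≡ j → lo < i → i < j → lo < c i × c i < j
  nested {lo} {j} {i} j<m clo≡j lo<i i<j with <-cmp (c i) lo | <-cmp (c i) j
  ... | tri< ci<lo _ _ | _ = ⊥-elim (nonCrossing ci<lo lo<i i<j j<m (involutive i<m) clo≡j)
    where i<m = <-trans i<j j<m
  ... | tri≈ _ ci≡lo _ | _ = ⊥-elim (<-irrefl i≡j i<j)
    where i≡j = trans (sym (involutive (<-trans i<j j<m))) (trans (cong c ci≡lo) clo≡j)
  ... | tri> _ _ lo<ci | tri< ci<j _ _ = lo<ci , ci<j
  ... | tri> _ _ _ | tri≈ _ ci≡j _ = ⊥-elim (<-irrefl lo≡i lo<i)
    where lo≡i = injective (<-trans lo<i (<-trans i<j j<m)) (<-trans i<j j<m) (trans clo≡j (sym ci≡j))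
  ... | tri> _ _ _ | tri> _ _ j<ci = ⊥-elim (nonCrossing lo<i i<j j<ci (bounded (<-trans i<j j<m)) clo≡j refl)

  partner-beyond : ∀ {lo j i} → j < m → c lo ≡ j → lo < j → j < i → i < m → lo ≤ c i → j < c i
  partner-beyond {lo} {j} {i} j<m clo≡j lo<j j<i i<m lo≤ci with <-cmp (c i) j | m≤n⇒m<n∨m≡n lo≤ci
  ... | tri> _ _ j<ci | _ = j<ci
  ... | tri≈ _ ci≡j _ | _ = ⊥-elim (<-asym lo<j (subst (j <_) i≡lo j<i))
    where i≡lo = injective i<m (<-trans lo<j j<m) (trans ci≡j (sym clo≡j))
  ... | tri< _ _ _ | inj₂ lo≡ci = ⊥-elim (<-irrefl j≡i j<i)
    where j≡i = trans (sym clo≡j) (trans (cong c lo≡ci) (involutive i<m))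
  ... | tri< ci<j _ _ | inj₁ lo<ci =
    ⊥-elim (<-asym j<i (subst (_< j) (involutive i<m) (proj₂ (nested j<m clo≡j lo<ci ci<j))))

  ClosedOn : ℕ → ℕ → Set
  ClosedOn lo hi = ∀ {i} → lo ≤ i → i < hi → lo ≤ c i × c i < hi

  closedOn⇒even : ∀ {lo hi} → Acc _<_ (hi ∸ lo) → hi ≤ m → ClosedOn lo hi → parity (hi ∸ lo) ≡ 0ℙ
  closedOn⇒even {lo} {hi} (acc shorter) hi≤m closed with lo <? hi
  ... | no lo≮hi = cong parity (m≤n⇒m∸n≡0 (≮⇒≥ lo≮hi))
  -- the chord from lo to j = c lo splits [lo, hi) into itself and the closed intervals (lo, j), (j, hi)
  ... | yes lo<hi = begin
    parity (hi ∸ lo)           ≡⟨ cong parity split ⟩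
    parity (L₁ + L₂)           ≡⟨ ℙₚ.+-homo-+ L₁ L₂ ⟩
    parity L₁ ℙ.+ parity L₂    ≡⟨ cong₂ ℙ._+_ (closedOn⇒even (shorter L₁<) (<⇒≤ j<m) inside)
                                              (closedOn⇒even (shorter L₂<) hi≤m outside) ⟩
    0ℙ                         ∎
    where
    open ≡-Reasoning
    j = c lo
    lo≤j×j<hi = closed ≤-refl lo<hi
    j<hi = proj₂ lo≤j×j<hi
    j<m = <-≤-trans j<hi hi≤m
    lo<j : lo < j
    lo<j = ≤∧≢⇒< (proj₁ lo≤j×j<hi) (≢-sym (fixedPointFree (<-≤-trans lo<hi hi≤m)))
    L₁ = j ∸ suc lo
    L₂ = hi ∸ suc j
    split = ∸-split lo<j j<hi
    L₁+L₂< : L₁ + L₂ < hi ∸ lo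
    L₁+L₂< = subst (L₁ + L₂ <_) (sym split) (m<n⇒m<1+n (n<1+n _))
    L₁< = ≤-<-trans (m≤m+n L₁ L₂) L₁+L₂<
    L₂< = ≤-<-trans (m≤n+m L₂ L₁) L₁+L₂<
    inside : ClosedOn (suc lo) j
    inside lo<i i<j = nested j<m refl lo<i i<j
    outside : ClosedOn (suc j) hi
    outside {i} j<i i<hi with closed (<⇒≤ (<-trans lo<j j<i)) i<hi
    ... | lo≤ci , ci<hi = partner-beyond j<m refl lo<j j<i (<-≤-trans i<hi hi≤m) lo≤ci , ci<hi

  partner-of-0-odd : 0 < m → parity (c 0) ≡ 1ℙ
  partner-of-0-odd 0<m with c 0 in c0≡j | fixedPointFree 0<m | bounded 0<m
  ... | zero  | c0≢0 | _   = contradiction refl c0≢0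
  ... | suc k | _    | j<m = parity-suc {k} (closedOn⇒even {1} {suc k} (<-wellFounded k) (<⇒≤ j<m) inside)
    where
    inside : ClosedOn 1 (suc k)
    inside 0<i i<j = nested j<m c0≡j 0<i i<j

iter-+ : ∀ {A : Set} (f : A → A) i j x → iter f (i + j) x ≡ iter f i (iter f j x)
iter-+ f zero    j x = refl
iter-+ f (suc i) j x = cong f (iter-+ f i j x)

iter-* : ∀ {A : Set} (f : A → A) {d x} → iter f d x ≡ x → ∀ q → iter f (q * d) x ≡ x
iter-* f         e zero    = refl
iter-* f {d} {x} e (suc q) = trans (iter-+ f d (q * d) x) (trans (cong (iter f d) (iter-* f e q)) e)

iter-% : ∀ {A : Set} (f : A → A) {d x} .{{_ : NonZero d}} →
         iter f d x ≡ x → ∀ k → iter f k x ≡ iter f (k % d) x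
iter-% f {d} {x} period k = begin
  iter f k x                               ≡⟨ cong (λ l → iter f l x) (m≡m%n+[m/n]*n k d) ⟩
  iter f (k % d + (k / d) * d) x           ≡⟨ iter-+ f (k % d) ((k / d) * d) x ⟩
  iter f (k % d) (iter f ((k / d) * d) x)  ≡⟨ cong (iter f (k % d)) (iter-* f period (k / d)) ⟩
  iter f (k % d) x                         ∎
  where open ≡-Reasoning

^-injective : ∀ {m} (σ : Permutation′ m) k {x y} → (σ ^[ k ]) x ≡ (σ ^[ k ]) y → x ≡ y
^-injective σ zero    e = e
^-injective σ (suc k) e = ^-injective σ k (trans (sym (inverseˡ σ)) (trans (cong (σ ⟨$⟩ˡ_) e) (inverseˡ σ)))

^-∸ : ∀ {m} (σ : Permutation′ m) {i j x} → i ≤ j → (σ ^[ i ]) x ≡ (σ ^[ j ]) x → (σ ^[ j ∸ i ]) x ≡ x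
^-∸ σ {i} {j} {x} i≤j e = sym (^-injective σ i (begin
  (σ ^[ i ]) x                   ≡⟨ e ⟩
  (σ ^[ j ]) x                   ≡⟨ cong (λ k → (σ ^[ k ]) x) (m+[n∸m]≡n i≤j) ⟨
  (σ ^[ i + (j ∸ i) ]) x         ≡⟨ iter-+ _ i (j ∸ i) x ⟩
  (σ ^[ i ]) ((σ ^[ j ∸ i ]) x)  ∎))
  where open ≡-Reasoning

DistParity : ∀ {m} → Permutation′ m → Parity → Fin m → Fin m → Set
DistParity σ p x y = ∃[ k ] (parity k ≡ p × (σ ^[ k ]) x ≡ y)

distParity-trans : ∀ {m} {σ : Permutation′ m} {p q x y z} →
                   DistParity σ p x y → DistParity σ q y z → DistParity σ (q ℙ.+ p) x z
distParity-trans {σ = σ} {x = x} (k , pk , σᵏx≡y) (l , pl , σˡy≡z) =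
  l + k , trans (ℙₚ.+-homo-+ l k) (cong₂ ℙ._+_ pl pk) ,
  trans (iter-+ _ l k x) (trans (cong (σ ^[ l ]) σᵏx≡y) σˡy≡z)

evenDist⇔distParity0ℙ : ∀ {m} {σ : Permutation′ m} {x y} → EvenDist σ x y ⇔ DistParity σ 0ℙ x y
evenDist⇔distParity0ℙ = mk⇔ (λ (k , 2∣k , e) → k , even⇒parity≡0ℙ k 2∣k , e)
                            (λ (k , pk , e) → k , parity≡0ℙ⇒even k pk , e)

distParity-word : ∀ {m} (ρ : Fin 3 → Fin m → Fin m) (σ : Permutation′ m) →
                  (∀ g x → DistParity σ 1ℙ x (ρ g x)) →
                  ∀ w x → DistParity σ (parity (length w)) x (applyWord ρ w x)
distParity-word ρ σ odd-step []      x = 0 , refl , refl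
distParity-word ρ σ odd-step (g ∷ w) x =
  subst (λ p → DistParity σ p x (applyWord ρ (g ∷ w) x)) (sym (ℙₚ.+-homo-+ 1 (length w)))
        (distParity-trans {σ = σ} (distParity-word ρ σ odd-step w x) (odd-step g (applyWord ρ w x)))

module CyclicOrder {m : ℕ} (σ : Permutation′ m) (cyclic : IsCyclicOrder σ) where

  no-short-period : ∀ {d x} → 0 < d → d < m → (σ ^[ d ]) x ≢ x
  no-short-period {d@(suc _)} {x} _ d<m period = <⇒≱ d<m (injective⇒≤ residue-injective)
    where
    residue : Fin m → Fin d
    residue b = fromℕ< (m%n<n (proj₁ (cyclic x b)) d)
    ^-residue : ∀ b → (σ ^[ toℕ (residue b) ]) x ≡ b
    ^-residue b = begin
      (σ ^[ toℕ (residue b) ]) x  ≡⟨ cong (λ r → (σ ^[ r ]) x) (toℕ-fromℕ< (m%n<n k d)) ⟩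
      (σ ^[ k % d ]) x            ≡⟨ iter-% _ period k ⟨
      (σ ^[ k ]) x                ≡⟨ proj₂ (cyclic x b) ⟩
      b                           ∎
      where
      open ≡-Reasoning
      k = proj₁ (cyclic x b)
    residue-injective : ∀ {b b′} → residue b ≡ residue b′ → b ≡ b′
    residue-injective {b} {b′} e =
      trans (sym (^-residue b)) (trans (cong (λ r → (σ ^[ toℕ r ]) x) e) (^-residue b′))

  period≤m⇒order : ∀ {d x} → 0 < d → d ≤ m → (σ ^[ d ]) x ≡ x → (σ ^[ m ]) x ≡ x
  period≤m⇒order {x = x} 0<d d≤m period with m≤n⇒m<n∨m≡n d≤m
  ... | inj₁ d<m = contradiction period (no-short-period 0<d d<m)
  ... | inj₂ d≡m = subst (λ k → (σ ^[ k ]) x ≡ x) d≡m period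

  ^-order : ∀ x → (σ ^[ m ]) x ≡ x
  ^-order x with i , j , i<j , σⁱx≡σʲx ← pigeonhole ≤-refl (λ (i : Fin (suc m)) → (σ ^[ toℕ i ]) x) =
    period≤m⇒order (m<n⇒0<n∸m i<j) (≤-trans (m∸n≤m (toℕ j) (toℕ i)) (m<1+n⇒m≤n (toℕ<n j)))
                   (^-∸ σ (<⇒≤ i<j) σⁱx≡σʲx)

  period⇒m∣ : ∀ {d x} → (σ ^[ d ]) x ≡ x → m ∣ d
  period⇒m∣ {d} {x} period = m%n≡0⇒n∣m d m (n≤0⇒n≡0 (≮⇒≥ residue-not-period))
    where
    instance
      m-nonZero : NonZero m
      m-nonZero = nonZeroIndex x
    residue-not-period : ¬ (0 < d % m)
    residue-not-period 0<r = no-short-period 0<r (m%n<n d m) (trans (sym (iter-% _ (^-order x) d)) period)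

  ^-≡⇒m∣∸ : ∀ {i j x} → i ≤ j → (σ ^[ i ]) x ≡ (σ ^[ j ]) x → m ∣ j ∸ i
  ^-≡⇒m∣∸ i≤j e = period⇒m∣ (^-∸ σ i≤j e)

  ^-injectiveˡ-≤ : ∀ {i j x} → i ≤ j → j < m → (σ ^[ i ]) x ≡ (σ ^[ j ]) x → i ≡ j
  ^-injectiveˡ-≤ {i} {j} i≤j j<m e =
    ≤-antisym i≤j (m∸n≡0⇒m≤n (∣∧<⇒≡0 (^-≡⇒m∣∸ i≤j e) (≤-<-trans (m∸n≤m j i) j<m)))

  ^-injectiveˡ : ∀ {i j x} → i < m → j < m → (σ ^[ i ]) x ≡ (σ ^[ j ]) x → i ≡ j
  ^-injectiveˡ {i} {j} i<m j<m e with ≤-total i j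
  ... | inj₁ i≤j = ^-injectiveˡ-≤ i≤j j<m e
  ... | inj₂ j≤i = sym (^-injectiveˡ-≤ j≤i i<m (sym e))

  ^-≡⇒parity≡-≤ : 2 ∣ m → ∀ {i j x} → i ≤ j → (σ ^[ i ]) x ≡ (σ ^[ j ]) x → parity i ≡ parity j
  ^-≡⇒parity≡-≤ 2∣m {i} {j} i≤j e = begin
    parity i                        ≡⟨ ℙₚ.+-identityʳ (parity i) ⟨
    parity i ℙ.+ 0ℙ                 ≡⟨ cong (parity i ℙ.+_) (even⇒parity≡0ℙ (j ∸ i) (∣-trans 2∣m (^-≡⇒m∣∸ i≤j e))) ⟨
    parity i ℙ.+ parity (j ∸ i)     ≡⟨ ℙₚ.+-homo-+ i (j ∸ i) ⟨
    parity (i + (j ∸ i))            ≡⟨ cong parity (m+[n∸m]≡n i≤j) ⟩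
    parity j                        ∎
    where open ≡-Reasoning

  ^-≡⇒parity≡ : 2 ∣ m → ∀ {i j x} → (σ ^[ i ]) x ≡ (σ ^[ j ]) x → parity i ≡ parity j
  ^-≡⇒parity≡ 2∣m {i} {j} e with ≤-total i j
  ... | inj₁ i≤j = ^-≡⇒parity≡-≤ 2∣m i≤j e
  ... | inj₂ j≤i = sym (^-≡⇒parity≡-≤ 2∣m j≤i (sym e))

  module _ (a : Fin m) where
    instance
      m-nonZero : NonZero m
      m-nonZero = nonZeroIndex a

    position : Fin m → ℕ
    position b = proj₁ (cyclic a b) % m

    position<m : ∀ b → position b < m
    position<m b = m%n<n (proj₁ (cyclic a b)) m

    ^-position : ∀ b → (σ ^[ position b ]) a ≡ b
    ^-position b = trans (sym (iter-% _ (^-order a) (proj₁ (cyclic a b)))) (proj₂ (cyclic a b))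

  distParity-unique : 2 ∣ m → ∀ {p q x y} → DistParity σ p x y → DistParity σ q x y → p ≡ q
  distParity-unique 2∣m (k , pk , σᵏx≡y) (l , pl , σˡx≡y) =
    trans (sym pk) (trans (^-≡⇒parity≡ 2∣m {k} {l} (trans σᵏx≡y (sym σˡx≡y))) pl)

  module Chords (ρ : Fin m → Fin m) (ρ-fpfInvolution : IsFPFInvolution ρ) (ρ-free : IntersectionFree ρ σ)
                (a : Fin m) where

    chord : ℕ → ℕ
    chord i = position a (ρ ((σ ^[ i ]) a))

    ^-chord : ∀ i → (σ ^[ chord i ]) a ≡ ρ ((σ ^[ i ]) a)
    ^-chord i = ^-position a (ρ ((σ ^[ i ]) a))

    chord-involutive : ∀ {i} → i < m → chord (chord i) ≡ i
    chord-involutive {i} i<m = ^-injectiveˡ (position<m a _) i<m (begin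
      (σ ^[ chord (chord i) ]) a    ≡⟨ ^-chord (chord i) ⟩
      ρ ((σ ^[ chord i ]) a)        ≡⟨ cong ρ (^-chord i) ⟩
      ρ (ρ ((σ ^[ i ]) a))          ≡⟨ proj₁ ρ-fpfInvolution _ ⟩
      (σ ^[ i ]) a                  ∎)
      where open ≡-Reasoning

    chord-fixedPointFree : ∀ {i} → chord i ≢ i
    chord-fixedPointFree {i} chord[i]≡i =
      proj₂ ρ-fpfInvolution ((σ ^[ i ]) a) (trans (sym (^-chord i)) (cong (λ k → (σ ^[ k ]) a) chord[i]≡i))

    chords-nonCrossing : ∀ {u s v t} → u < s → s < v → v < t → t < m → chord u ≡ v → chord s ≡ t → ⊥
    chords-nonCrossing {u} {s} {v} {t} u<s s<v v<t t<m chord[u]≡v chord[s]≡t =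
      ρ-free (x , s ∸ u , v ∸ u , t ∸ u ,
              m<n⇒0<n∸m u<s , ∸-monoˡ-< s<v u≤s , ∸-monoˡ-< v<t u≤v , ≤-<-trans (m∸n≤m t u) t<m ,
              ρx≡σ^[v∸u]x , ρσ^[s∸u]x≡σ^[t∸u]x)
      where
      open ≡-Reasoning
      x = (σ ^[ u ]) a
      u≤s = <⇒≤ u<s
      u≤v = ≤-trans u≤s (<⇒≤ s<v)
      u≤t = ≤-trans u≤v (<⇒≤ v<t)
      seen-from-x : ∀ {w} → u ≤ w → (σ ^[ w ]) a ≡ (σ ^[ w ∸ u ]) x
      seen-from-x {w} u≤w = trans (cong (λ k → (σ ^[ k ]) a) (sym (m∸n+n≡m u≤w))) (iter-+ _ (w ∸ u) u a)
      ρx≡σ^[v∸u]x : ρ x ≡ (σ ^[ v ∸ u ]) x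
      ρx≡σ^[v∸u]x = begin
        ρ x                        ≡⟨ ^-chord u ⟨
        (σ ^[ chord u ]) a         ≡⟨ cong (λ k → (σ ^[ k ]) a) chord[u]≡v ⟩
        (σ ^[ v ]) a               ≡⟨ seen-from-x u≤v ⟩
        (σ ^[ v ∸ u ]) x           ∎
      ρσ^[s∸u]x≡σ^[t∸u]x : ρ ((σ ^[ s ∸ u ]) x) ≡ (σ ^[ t ∸ u ]) x
      ρσ^[s∸u]x≡σ^[t∸u]x = begin
        ρ ((σ ^[ s ∸ u ]) x)       ≡⟨ cong ρ (seen-from-x u≤s) ⟨
        ρ ((σ ^[ s ]) a)           ≡⟨ ^-chord s ⟨
        (σ ^[ chord s ]) a         ≡⟨ cong (λ k → (σ ^[ k ]) a) chord[s]≡t ⟩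
        (σ ^[ t ]) a               ≡⟨ seen-from-x u≤t ⟩
        (σ ^[ t ∸ u ]) x           ∎

    chord-isNonCrossingMatching : IsNonCrossingMatching m chord
    chord-isNonCrossingMatching = record
      { bounded        = λ _ → position<m a _
      ; involutive     = chord-involutive
      ; fixedPointFree = λ _ → chord-fixedPointFree
      ; nonCrossing    = chords-nonCrossing
      }

    ρ-oddDistance : DistParity σ 1ℙ a (ρ a)
    ρ-oddDistance = chord 0 , partner-of-0-odd (≤-<-trans z≤n (toℕ<n a)) , ^-chord 0
      where open NonCrossingMatching chord-isNonCrossingMatching

evenDist⇔even-word : ∀ {m} (ρ : Fin 3 → Fin m → Fin m) → (∀ g → IsFPFInvolution (ρ g)) →
                     (σ : Permutation′ m) → IsCyclicOrder σ → (∀ g → IntersectionFree (ρ g) σ) → 2 ∣ m →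
                     ∀ {a b} w → applyWord ρ w a ≡ b → EvenDist σ a b ⇔ parity (length w) ≡ 0ℙ
evenDist⇔even-word ρ fpf σ cyclic free 2∣m {a} {b} w w[a]≡b = even-word⇔ ⇔-∘ evenDist⇔distParity0ℙ {σ = σ}
  where
  open CyclicOrder σ cyclic
  word-distance : DistParity σ (parity (length w)) a b
  word-distance = subst (DistParity σ _ a) w[a]≡b
    (distParity-word ρ σ (λ g → Chords.ρ-oddDistance (ρ g) (fpf g) (free g)) w a)
  even-word⇔ : DistParity σ 0ℙ a b ⇔ parity (length w) ≡ 0ℙ
  even-word⇔ = mk⇔ (λ d → distParity-unique 2∣m word-distance d)
                   (λ even → subst (λ p → DistParity σ p a b) even word-distance)

lemma5p4 : (n : ℕ) → 1 ≤ n →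
    (ρ : Fin 3 → Fin (2 * n) → Fin (2 * n)) →
    (∀ g → IsFPFInvolution (ρ g)) →
    GeneratesTransitive ρ →
    (σ σ′ : Permutation′ (2 * n)) →
    IsCyclicOrder σ → IsCyclicOrder σ′ →
    (∀ g → IntersectionFree (ρ g) σ) →
    (∀ g → IntersectionFree (ρ g) σ′) →
    ∀ (a b : Fin (2 * n)) → EvenDist σ a b ⇔ EvenDist σ′ a b
lemma5p4 n _ ρ fpf transitive σ σ′ cyclic cyclic′ free free′ a b =
  ⇔-sym (evenDist⇔even-word ρ fpf σ′ cyclic′ free′ 2∣2n w w[a]≡b)
    ⇔-∘ evenDist⇔even-word ρ fpf σ cyclic free 2∣2n w w[a]≡b
  where
  2∣2n : 2 ∣ 2 * n
  2∣2n = divides n (*-comm 2 n)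
  w = proj₁ (transitive a b)
  w[a]≡b = proj₂ (transitive a b)
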